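{- Let $\Theta=(\alpha,\beta,\gamma)\in S_n\times S_n\times S_n$ be such that $\Delta(\Theta)>0$. If $t\in\{1,\dots,n\}$ satisfies $\mathbf{l}^\gamma_t>0$, then there exist $r,s\in\{1,\dots,n\}$ with $\mathbf{l}^\alpha_r\cdot\mathbf{l}^\beta_s>0$ such that $t$ divides $\mathrm{lcm}(r,s)$.
   Context: Let $N=\{0,1,\dots,n-1\}$ and $S_n$ the symmetric group on $N$. A Latin square of order $n$ is an $n\times n$ array $L=(l_{i,j})$ with entries in $N$ in which each symbol occurs exactly once in each row and column. For $\Theta=(\alpha,\beta,\gamma)\in S_n^3$, $L^\Theta$ is the array with $(i,j)$ entry $\gamma^{ -1}(l_{\alpha(i),\beta(j)})$; $\Theta$ is an autotopism of $L$ if $L^\Theta=L$. $\Delta(\Theta)$ is the number of Latin squares of order $n$ having $\Theta$ as an autotopism. For $\delta\in S_n$, $\mathbf{l}^\delta_r$ is the number of cycles of length $r$ in its disjoint cycle decomposition (fixed points are cycles of length 1). -}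

module Defs where

open import Data.Nat using (ℕ; zero; suc; _+_; _∸_)
open import Data.Nat.DivMod using (_/_)
open import Data.Bool using (Bool; true; false; _∧_; not)
open import Data.Fin using (Fin; _≟_)
open import Data.Fin.Permutation using (Permutation′; _⟨$⟩ʳ_; _⟨$⟩ˡ_)
open import Data.List using (List; allFin; upTo; map)
open import Data.Bool.ListAction using (and)
open import Data.Nat.ListAction using (sum)
open import Data.Product using (Σ; _×_; ∃!)
open import Relation.Nullary.Decidable using (⌊_⌋)
open import Relation.Binary.PropositionalEquality using (_≡_)

Perm : ℕ → Set
Perm n = Permutation′ n

Array : ℕ → Set
Array n = Fin n → Fin n → Fin n

IsLatinSquare : {n : ℕ} → Array n → Set
IsLatinSquare {n} L =
  ((i k : Fin n) → ∃! _≡_ (λ j → L i j ≡ k)) ×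
  ((j k : Fin n) → ∃! _≡_ (λ i → L i j ≡ k))

_^Θ_ : {n : ℕ} → Array n → Perm n × Perm n × Perm n → Array n
(L ^Θ (α Data.Product., β Data.Product., γ)) i j = γ ⟨$⟩ˡ L (α ⟨$⟩ʳ i) (β ⟨$⟩ʳ j)

IsAutotopism : {n : ℕ} → Perm n × Perm n × Perm n → Array n → Set
IsAutotopism {n} Θ L = (i j : Fin n) → (L ^Θ Θ) i j ≡ L i j

-- Δ(Θ) > 0 : some Latin square of order n has Θ as an autotopism
ΔPositive : {n : ℕ} → Perm n × Perm n × Perm n → Set
ΔPositive {n} Θ = Σ (Array n) (λ L → IsLatinSquare L × IsAutotopism Θ L)

iter : {n : ℕ} → Perm n → ℕ → Fin n → Fin n
iter δ zero    x = x
iter δ (suc k) x = δ ⟨$⟩ʳ iter δ k x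

fixedBy : {n : ℕ} → Perm n → ℕ → Fin n → Bool
fixedBy δ k x = ⌊ iter δ k x ≟ x ⌋

onCycleOfLength : {n : ℕ} → Perm n → ℕ → Fin n → Bool
onCycleOfLength δ zero    x = false
onCycleOfLength δ (suc r) x =
  fixedBy δ (suc r) x ∧ and (map (λ k → not (fixedBy δ (suc k) x)) (upTo r))

boolToℕ : Bool → ℕ
boolToℕ true  = 1
boolToℕ false = 0

pointsOnCycles : {n : ℕ} → Perm n → ℕ → ℕ
pointsOnCycles {n} δ r = sum (map (λ x → boolToℕ (onCycleOfLength δ r x)) (allFin n))

-- l^δ_r : the number of cycles of length r of δ (each such cycle has r points)
cycleCount : {n : ℕ} → Perm n → ℕ → ℕ
cycleCount δ zero    = 0
cycleCount δ (suc r) = pointsOnCycles δ (suc r) / suc r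

module Submission where

-- Fix a Latin square L with autotopism (α, β, γ), and a point x
-- lying on a t-cycle of γ, i.e. t is the least period of x under γ.  Since
-- row x of L contains every symbol, there is a column j with L x j = x.  Let
-- r and s be the least periods of x under α and of j under β; then
-- α^m x = x and β^m j = j for m = lcm r s, and iterating the autotopism
-- equation gives γ^m x = γ^m (L x j) = L (α^m x) (β^m j) = L x j = x.
-- A least period divides every period, so t ∣ lcm r s; and x, j witness
-- l^α_r > 0 and l^β_s > 0.

open import Defs
open import Data.Nat using (ℕ; _*_; _≤_; _<_)
open import Data.Nat.Divisibility using (_∣_)
open import Data.Nat.LCM using (lcm)
open import Data.Product using (Σ; _×_; _,_)

open import Data.Product using (proj₁; proj₂)
open import Data.Bool using (Bool; true; false; T; not)
open import Data.Bool.ListAction using (and)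
open import Data.Bool.Properties using (T-∧)
open import Data.Fin using (Fin; toℕ; fromℕ<; inject; punchIn; _≟_) renaming (zero to fzero)
open import Data.Fin.Properties
  using (any?; pigeonhole; punchIn-injective; punchInᵢ≢i; toℕ-injective; toℕ<n; toℕ-fromℕ<; toℕ-inject; ¬∀⟶∃¬-smallest)
open import Data.Fin.Permutation using (_⟨$⟩ʳ_; _⟨$⟩ˡ_; inverseˡ; inverseʳ)
open import Data.List using (List; []; _∷_; map; allFin; upTo)
open import Data.List.Membership.Propositional using (_∈_)
open import Data.List.Membership.Propositional.Properties using (∈-allFin)
import Data.List.Relation.Unary.Any as Any
open import Data.List.Relation.Unary.All.Properties using (all⁺; all⁻; applyUpTo⁺₁; applyUpTo⁻)
open import Data.Nat using (zero; suc; _+_; z≤n; s≤s; z<s; NonZero; >-nonZero)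
open import Data.Nat.Properties
  using (+-comm; +-suc; +-identityʳ; ≤-trans; ≤-pred; ≤-<-trans; m≤n+m; n<1+n; ≤-total; *-mono-≤; m≤n⇒∃[o]m+o≡n)
open import Data.Nat.DivMod using (_/_; _%_; m≡m%n+[m/n]*n; m%n<n; m/n≤m; m≥n⇒m/n>0)
open import Data.Nat.Divisibility using (divides; m%n≡0⇒n∣m)
open import Data.Nat.LCM using (m∣lcm[m,n]; n∣lcm[m,n])
open import Data.Nat.ListAction using (sum)
open import Data.Empty using (⊥-elim)
open import Data.Sum using (inj₁; inj₂)
open import Data.Unit using (tt)
open import Function using (id; _∘_; Equivalence)
open import Function.Definitions using (Injective)
open import Relation.Binary.Definitions using (DecidableEquality)
open import Relation.Binary.PropositionalEquality
  using (_≡_; _≢_; refl; sym; trans; cong; cong₂; subst; module ≡-Reasoning)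
open import Relation.Nullary using (¬?; yes; no)
open import Relation.Nullary.Decidable using (toWitness; fromWitness; toWitnessFalse; fromWitnessFalse; decidable-stable)

open ≡-Reasoning

iter-+ : ∀ {n} (δ : Perm n) a b x → iter δ (a + b) x ≡ iter δ a (iter δ b x)
iter-+ δ zero    b x = refl
iter-+ δ (suc a) b x = cong (δ ⟨$⟩ʳ_) (iter-+ δ a b x)

iter-comm : ∀ {n} (δ : Perm n) a b x → iter δ a (iter δ b x) ≡ iter δ b (iter δ a x)
iter-comm δ a b x = begin
  iter δ a (iter δ b x) ≡⟨ sym (iter-+ δ a b x) ⟩
  iter δ (a + b) x      ≡⟨ cong (λ k → iter δ k x) (+-comm a b) ⟩
  iter δ (b + a) x      ≡⟨ iter-+ δ b a x ⟩
  iter δ b (iter δ a x) ∎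

iter-injective : ∀ {n} (δ : Perm n) a {x y} → iter δ a x ≡ iter δ a y → x ≡ y
iter-injective δ zero    eq = eq
iter-injective δ (suc a) eq =
  iter-injective δ a (trans (sym (inverseˡ δ)) (trans (cong (δ ⟨$⟩ˡ_) eq) (inverseˡ δ)))

iter-cancel : ∀ {n} (δ : Perm n) a k {x} → iter δ a x ≡ iter δ (a + k) x → iter δ k x ≡ x
iter-cancel δ a k {x} eq = sym (iter-injective δ a (trans eq (iter-+ δ a k x)))

iter-multiple : ∀ {n} (δ : Perm n) {p x m} → iter δ p x ≡ x → p ∣ m → iter δ m x ≡ x
iter-multiple δ {p} {x} fix (divides q refl) = go q
  where
  go : ∀ q → iter δ (q * p) x ≡ x
  go zero    = refl
  go (suc q) = trans (iter-+ δ p (q * p) x) (trans (cong (iter δ p) (go q)) fix)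

record LeastPeriod {n} (δ : Perm n) (x : Fin n) (p : ℕ) : Set where
  field
    positive : 0 < p
    returns  : iter δ p x ≡ x
    minimal  : ∀ {k} → 0 < k → k < p → iter δ k x ≢ x

open LeastPeriod

leastPeriod-below : ∀ {n} {δ : Perm n} {x p d} → LeastPeriod δ x p →
  d < p → iter δ d x ≡ x → d ≡ 0
leastPeriod-below {d = zero}  _  _   _   = refl
leastPeriod-below {d = suc d} lp d<p fix = ⊥-elim (minimal lp z<s d<p fix)

-- The least period divides every period (reduce m modulo p).
leastPeriod-∣ : ∀ {n} {δ : Perm n} {x p m} → LeastPeriod δ x p → iter δ m x ≡ x → p ∣ m
leastPeriod-∣ {δ = δ} {x} {p} {m} lp fix =
  m%n≡0⇒n∣m m p (leastPeriod-below lp (m%n<n m p) remainder-fixed)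
  where
  instance
    p≢0 : NonZero p
    p≢0 = >-nonZero (positive lp)
  remainder-fixed : iter δ (m % p) x ≡ x
  remainder-fixed = begin
    iter δ (m % p) x                      ≡⟨ cong (iter δ (m % p))
                                              (sym (iter-multiple δ (returns lp) (divides (m / p) refl))) ⟩
    iter δ (m % p) (iter δ (m / p * p) x) ≡⟨ sym (iter-+ δ (m % p) (m / p * p) x) ⟩
    iter δ (m % p + m / p * p) x          ≡⟨ cong (λ k → iter δ k x) (sym (m≡m%n+[m/n]*n m p)) ⟩
    iter δ m x                            ≡⟨ fix ⟩
    x                                     ∎

orbit : ∀ {n} (δ : Perm n) (x : Fin n) (p : ℕ) → Fin p → Fin n
orbit δ x p a = iter δ (toℕ a) x

orbit-leastPeriod : ∀ {n} {δ : Perm n} {x p} → LeastPeriod δ x p → ∀ a → LeastPeriod δ (iter δ a x) p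
orbit-leastPeriod {δ = δ} {x} {p} lp a = record
  { positive = positive lp
  ; returns  = trans (iter-comm δ p a x) (cong (iter δ a) (returns lp))
  ; minimal  = λ {k} 0<k k<p eq →
      minimal lp 0<k k<p (iter-injective δ a (trans (iter-comm δ a k x) eq))
  }

-- δ^a x = δ^b x with a ≤ b < p forces a = b, as δ^(b-a) then fixes x.
orbit-distinct : ∀ {n} {δ : Perm n} {x p a b} → LeastPeriod δ x p →
  a ≤ b → b < p → iter δ a x ≡ iter δ b x → a ≡ b
orbit-distinct {δ = δ} {a = a} lp a≤b b<p eq with m≤n⇒∃[o]m+o≡n a≤b
... | d , refl = sym (trans (cong (a +_) d≡0) (+-identityʳ a))
  where
  d≡0 : d ≡ 0
  d≡0 = leastPeriod-below lp (≤-<-trans (m≤n+m d a) b<p) (iter-cancel δ a d eq)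

orbit-injective : ∀ {n} {δ : Perm n} {x p} → LeastPeriod δ x p → Injective _≡_ _≡_ (orbit δ x p)
orbit-injective lp {a} {b} eq with ≤-total (toℕ a) (toℕ b)
... | inj₁ a≤b = toℕ-injective (orbit-distinct lp a≤b (toℕ<n b) eq)
... | inj₂ b≤a = toℕ-injective (sym (orbit-distinct lp b≤a (toℕ<n a) (sym eq)))

-- Some positive power δ^(i+1), i < n, fixes x: pigeonhole on x, δx, …, δⁿx.
iter-returns : ∀ {n} (δ : Perm n) x → Σ (Fin n) λ i → iter δ (suc (toℕ i)) x ≡ x
iter-returns {n} δ x with pigeonhole (n<1+n n) (λ a → iter δ (toℕ a) x)
... | a , b , a<b , eq with m≤n⇒∃[o]m+o≡n a<b
... | d , a+1+d≡b = fromℕ< d<n , subst (λ k → iter δ (suc k) x ≡ x) (sym (toℕ-fromℕ< d<n)) δ¹⁺ᵈ-fixes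
  where
  b≡a+[1+d] : toℕ b ≡ toℕ a + suc d
  b≡a+[1+d] = sym (trans (+-suc (toℕ a) d) a+1+d≡b)
  δ¹⁺ᵈ-fixes : iter δ (suc d) x ≡ x
  δ¹⁺ᵈ-fixes = iter-cancel δ (toℕ a) (suc d) (trans eq (cong (λ k → iter δ k x) b≡a+[1+d]))
  d<n : d < n
  d<n = ≤-trans (subst (suc d ≤_) (sym b≡a+[1+d]) (m≤n+m (suc d) (toℕ a))) (≤-pred (toℕ<n b))

leastPeriod-exists : ∀ {n} (δ : Perm n) x → Σ ℕ λ p → p ≤ n × LeastPeriod δ x p
leastPeriod-exists {n} δ x
  with ¬∀⟶∃¬-smallest n (λ i → iter δ (suc (toℕ i)) x ≢ x)
         (λ i → ¬? (iter δ (suc (toℕ i)) x ≟ x))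
         (λ never → let i , ret = iter-returns δ x in never i ret)
... | i , returns-at-i , none-before = suc (toℕ i) , toℕ<n i , record
  { positive = z<s
  ; returns  = decidable-stable (iter δ (suc (toℕ i)) x ≟ x) returns-at-i
  ; minimal  = λ { {zero} () ; {suc k} _ (s≤s k<i) → none-below k<i }
  }
  where
  none-below : ∀ {k} → k < toℕ i → iter δ (suc k) x ≢ x
  none-below k<i = subst (λ k → iter δ (suc k) x ≢ x)
    (trans (toℕ-inject (fromℕ< k<i)) (toℕ-fromℕ< k<i)) (none-before (fromℕ< k<i))

-- The number of entries of xs satisfying P; pointsOnCycles δ p is
-- trueCount (onCycleOfLength δ p) (allFin n) by definition.
trueCount : ∀ {A : Set} → (A → Bool) → List A → ℕ
trueCount P xs = sum (map (λ x → boolToℕ (P x)) xs)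

boolToℕ-T : ∀ {b} → T b → boolToℕ b ≡ 1
boolToℕ-T {true} _ = refl

trueCount-witness : ∀ {A : Set} (P : A → Bool) xs → 0 < trueCount P xs → Σ A (T ∘ P)
trueCount-witness P (x ∷ xs) pos with P x in eq
... | true  = x , subst T (sym eq) tt
... | false = trueCount-witness P xs pos

-- If r distinct elements of xs satisfy P, then the count is at least r.
-- Induction on xs: the head is either hit by g (remove it from the
-- domain of g with punchIn) or not (g lands in the tail).
trueCount-injection : ∀ {A : Set} → DecidableEquality A → (P : A → Bool) (xs : List A) →
  ∀ {r} (g : Fin r → A) → Injective _≡_ _≡_ g →
  (∀ k → g k ∈ xs) → (∀ k → T (P (g k))) → r ≤ trueCount P xs
trueCount-injection _ _ _ {zero} _ _ _ _ = z≤n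
trueCount-injection _ _ [] {suc _} _ _ mem _ with () ← mem fzero
trueCount-injection _≟ᴬ_ P (x ∷ xs) {suc r} g inj mem Pg with any? (λ k → g k ≟ᴬ x)
... | yes (k₀ , refl) rewrite boolToℕ-T (Pg k₀) =
  s≤s (trueCount-injection _≟ᴬ_ P xs (g ∘ punchIn k₀)
        (λ e → punchIn-injective k₀ _ _ (inj e))
        (λ k → Any.tail (λ e → punchInᵢ≢i k₀ k (inj e)) (mem (punchIn k₀ k)))
        (Pg ∘ punchIn k₀))
... | no x∉img =
  ≤-trans (trueCount-injection _≟ᴬ_ P xs g inj
            (λ k → Any.tail (λ e → x∉img (k , e)) (mem k)) Pg)
          (m≤n+m _ (boolToℕ (P x)))

onCycle⇒leastPeriod : ∀ {n} (δ : Perm n) p x → T (onCycleOfLength δ p x) → LeastPeriod δ x p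
onCycle⇒leastPeriod δ (suc t) x on = record
  { positive = z<s
  ; returns  = toWitness fixed
  ; minimal  = λ { {zero} () ; {suc k} _ (s≤s k<t) →
      toWitnessFalse {a? = iter δ (suc k) x ≟ x} (applyUpTo⁻ id t (all⁺ notFixed (upTo t) earlier) k<t) }
  }
  where
  notFixed : ℕ → Bool
  notFixed k = not (fixedBy δ (suc k) x)
  split : T (fixedBy δ (suc t) x) × T (and (map notFixed (upTo t)))
  split = Equivalence.to T-∧ on
  fixed : T (fixedBy δ (suc t) x)
  fixed = proj₁ split
  earlier : T (and (map notFixed (upTo t)))
  earlier = proj₂ split

leastPeriod⇒onCycle : ∀ {n} {δ : Perm n} {x p} → LeastPeriod δ x p → T (onCycleOfLength δ p x)
leastPeriod⇒onCycle {p = zero} lp with () ← positive lp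
leastPeriod⇒onCycle {δ = δ} {x} {suc t} lp = Equivalence.from T-∧
  ( fromWitness (returns lp)
  , all⁻ _ (applyUpTo⁺₁ id t (λ {k} k<t →
      fromWitnessFalse {a? = iter δ (suc k) x ≟ x} (minimal lp z<s (s≤s k<t)))) )

-- l^δ_p > 0 as soon as some point has least period p: its orbit gives p
-- distinct points on cycles of length p.
leastPeriod⇒cycleCount-pos : ∀ {n} {δ : Perm n} {x p} → LeastPeriod δ x p → 0 < cycleCount δ p
leastPeriod⇒cycleCount-pos {p = zero} lp with () ← positive lp
leastPeriod⇒cycleCount-pos {n} {δ} {x} {suc t} lp = m≥n⇒m/n>0 orbit-counted
  where
  orbit-counted : suc t ≤ pointsOnCycles δ (suc t)
  orbit-counted = trueCount-injection _≟_ (onCycleOfLength δ (suc t)) (allFin n)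
    (orbit δ x (suc t)) (orbit-injective lp) (λ a → ∈-allFin _)
    (λ a → leastPeriod⇒onCycle (orbit-leastPeriod lp (toℕ a)))

cycleCount-pos⇒leastPeriod : ∀ {n} {δ : Perm n} {p} → 0 < cycleCount δ p →
  Σ (Fin n) λ x → LeastPeriod δ x p
cycleCount-pos⇒leastPeriod {n} {δ} {suc t} pos with
  trueCount-witness (onCycleOfLength δ (suc t)) (allFin n)
    (≤-trans pos (m/n≤m (pointsOnCycles δ (suc t)) (suc t)))
... | x , on = x , onCycle⇒leastPeriod δ (suc t) x on

autotopism-iter : ∀ {n} {α β γ : Perm n} {L : Array n} → IsAutotopism (α , β , γ) L →
  ∀ m i j → L (iter α m i) (iter β m j) ≡ iter γ m (L i j)
autotopism-iter                 auto zero    i j = refl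
autotopism-iter {α = α} {β} {γ} {L} auto (suc m) i j = begin
  L (α ⟨$⟩ʳ iter α m i) (β ⟨$⟩ʳ iter β m j)                  ≡⟨ sym (inverseʳ γ) ⟩
  γ ⟨$⟩ʳ (γ ⟨$⟩ˡ L (α ⟨$⟩ʳ iter α m i) (β ⟨$⟩ʳ iter β m j))  ≡⟨ cong (γ ⟨$⟩ʳ_) (auto (iter α m i) (iter β m j)) ⟩
  γ ⟨$⟩ʳ L (iter α m i) (iter β m j)                         ≡⟨ cong (γ ⟨$⟩ʳ_) (autotopism-iter auto m i j) ⟩
  γ ⟨$⟩ʳ iter γ m (L i j)                                    ∎

autotopism-fixes : ∀ {n} {α β γ : Perm n} {L : Array n} → IsAutotopism (α , β , γ) L →
  ∀ {m i j} → iter α m i ≡ i → iter β m j ≡ j → iter γ m (L i j) ≡ L i j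
autotopism-fixes {L = L} auto {m} {i} {j} αᵐi≡i βᵐj≡j =
  trans (sym (autotopism-iter auto m i j)) (cong₂ L αᵐi≡i βᵐj≡j)

proposition5 : (n : ℕ) (α β γ : Perm n) → ΔPositive (α , β , γ) →
    (t : ℕ) → 1 ≤ t → t ≤ n → 0 < cycleCount γ t →
    Σ ℕ (λ r → Σ ℕ (λ s → (1 ≤ r × r ≤ n) × (1 ≤ s × s ≤ n) ×
      0 < cycleCount α r * cycleCount β s × t ∣ lcm r s))
proposition5 n α β γ (L , (rows , _) , auto) t _ _ γ-has-t-cycle
  with cycleCount-pos⇒leastPeriod γ-has-t-cycle
... | x , γ-period with rows x x
... | j , Lxj≡x , _ with leastPeriod-exists α x | leastPeriod-exists β j
... | r , r≤n , α-period | s , s≤n , β-period =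
  r , s , (positive α-period , r≤n) , (positive β-period , s≤n) ,
  *-mono-≤ (leastPeriod⇒cycleCount-pos α-period) (leastPeriod⇒cycleCount-pos β-period) ,
  leastPeriod-∣ γ-period γ-fixes-x
  where
  m : ℕ
  m = lcm r s
  γ-fixes-x : iter γ m x ≡ x
  γ-fixes-x = subst (λ y → iter γ m y ≡ y) Lxj≡x
    (autotopism-fixes {α = α} {β} {γ} auto {m}
      (iter-multiple α (returns α-period) (m∣lcm[m,n] r s))
      (iter-multiple β (returns β-period) (n∣lcm[m,n] r s)))
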